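{- Let $n\ge1$ and $k\ge 0$ be integers and $s>0$. Consider the set of $s$-tuples $(\sigma_1,\dots,\sigma_s)$ of permutations of $[n]$ such that $\min(\sigma_i)\subseteq\min(\sigma_{i-1})$ for all $1<i\le s$ and $\sum_{j=1}^s|\min(\sigma_j)|=k+s-1$. The number of such $s$-tuples equals ${n\brack k}^{(s)}$.
   Context: For a permutation $\sigma$ of $[n]$, $\min(\sigma)$ denotes the set of minimal elements of the cycles of $\sigma$ (so $|\min(\sigma)|$ is the number of cycles). The $s$-elementary symmetric polynomial is $E_m^{(s)}(x_1,\dots,x_m')=\sum x_1^{a_1}\cdots x_{m'}^{a_{m'}}$, the sum over all tuples of nonnegative integers with sum $m$ and each $a_i\le s$, with $E_m^{(s)}=0$ for $m<0$. The modular $s$-Stirling numbers of the first kind are defined for $n\ge1$ by ${n\brack k}^{(s)}=((n-1)!)^{s}E_{k-1}^{(s)}\left(1,\tfrac{1}{2},\dots ,\tfrac{1}{n-1}\right)$. -}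

module Defs where

open import Data.Bool using (Bool; true; false; _∧_; _∨_; not; T; if_then_else_)
open import Data.Nat using (ℕ; zero; suc; _+_; _*_; _∸_; _≤ᵇ_; _≡ᵇ_)
open import Data.Nat using (_!)
open import Data.Nat.ListAction using (sum)
open import Data.Fin using (Fin; toℕ)
open import Data.Fin.Properties using (_≟_)
open import Data.List as List using (List; []; _∷_; map; concatMap; allFin; upTo; length; filter; zipWith)
open import Data.Vec using (Vec; []; _∷_; lookup)
open import Data.Integer using (ℤ; +_)
open import Data.Rational as ℚ using (ℚ; 0ℚ; 1ℚ; _/_)
open import Relation.Nullary.Decidable using (⌊_⌋)
open import Data.Product using (Σ; _×_)

allL : {A : Set} → (A → Bool) → List A → Bool
allL p []       = true
allL p (x ∷ xs) = p x ∧ allL p xs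

-- Permutations of [n] = {0,…,n-1} (0-based), represented by the vector
-- of their values (i ↦ lookup v i); a permutation is such a vector whose
-- map Fin n → Fin n is injective (hence bijective).

Perm-data : ℕ → Set
Perm-data n = Vec (Fin n) n

app : ∀ {n} → Perm-data n → Fin n → Fin n
app v i = lookup v i

isPerm : ∀ {n} → Perm-data n → Bool
isPerm {n} v = allL (λ i → allL (λ j → not ⌊ app v i ≟ app v j ⌋ ∨ ⌊ i ≟ j ⌋) (allFin n)) (allFin n)

iter : ∀ {n} → Perm-data n → ℕ → Fin n → Fin n
iter σ zero    i = i
iter σ (suc t) i = app σ (iter σ t i)

-- i ∈ min(σ): i is the minimal element of its cycle, i.e. every element
-- σ^t(i) (t = 0,…,n; this covers the whole cycle of i) is ≥ i.
isCycleMin : ∀ {n} → Perm-data n → Fin n → Bool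
isCycleMin {n} σ i = allL (λ t → toℕ i ≤ᵇ toℕ (iter σ t i)) (upTo (suc n))

numCycleMins : ∀ {n} → Perm-data n → ℕ
numCycleMins {n} σ = length (filter (λ i → T? (isCycleMin σ i)) (allFin n))
  where
  open import Relation.Nullary.Decidable using (Dec; yes; no)
  T? : (b : Bool) → Dec (T b)
  T? = Data.Bool.T?
    where import Data.Bool

minSubset : ∀ {n} → Perm-data n → Perm-data n → Bool
minSubset {n} τ σ = allL (λ i → not (isCycleMin τ i) ∨ isCycleMin σ i) (allFin n)

allPerms : ∀ {n s} → Vec (Perm-data n) s → Bool
allPerms []       = true
allPerms (σ ∷ σs) = isPerm σ ∧ allPerms σs

chainCond : ∀ {n s} → Vec (Perm-data n) s → Bool
chainCond []             = true
chainCond (σ ∷ [])       = true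
chainCond (σ ∷ τ ∷ σs)   = minSubset τ σ ∧ chainCond (τ ∷ σs)

sumCycles : ∀ {n s} → Vec (Perm-data n) s → ℕ
sumCycles []       = 0
sumCycles (σ ∷ σs) = numCycleMins σ + sumCycles σs

-- the set of s-tuples in the theorem (the conditions are Booleans, so
-- membership proofs are proof-irrelevant)
Tuples : (n s k : ℕ) → Set
Tuples n s k = Σ (Vec (Perm-data n) s) λ σs →
  T (allPerms σs) × T (chainCond σs) × T (sumCycles σs ≡ᵇ (k + s ∸ 1))

_^ℚ_ : ℚ → ℕ → ℚ
x ^ℚ zero  = 1ℚ
x ^ℚ suc a = x ℚ.* (x ^ℚ a)

sumℚ : List ℚ → ℚ
sumℚ = List.foldr ℚ._+_ 0ℚ

prodℚ : List ℚ → ℚ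
prodℚ = List.foldr ℚ._*_ 1ℚ

boundedTuples : (s len : ℕ) → List (List ℕ)
boundedTuples s zero      = [] ∷ []
boundedTuples s (suc len) =
  concatMap (λ a → map (a ∷_) (boundedTuples s len)) (upTo (suc s))

E : (s m : ℕ) → List ℚ → ℚ
E s m xs = sumℚ (map (λ as → prodℚ (zipWith _^ℚ_ xs as))
                     (filter (λ as → m Data.Nat.≟ sum as) (boundedTuples s (length xs))))
  where import Data.Nat

harmonicArgs : ℕ → List ℚ
harmonicArgs n = map (λ i → + 1 / suc i) (upTo (n ∸ 1))

-- modular s-Stirling number of the first kind [n k]^{(s)}, n ≥ 1;
-- E_{k-1} = 0 when k = 0.
modStirling1 : (s n k : ℕ) → ℚ
modStirling1 s n zero    = 0ℚ
modStirling1 s n (suc k) =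
  (((+ ((n ∸ 1) !)) / 1) ^ℚ s) ℚ.* E s k (harmonicArgs n)

module Submission where

-- Deleting the largest point n from its cycle sends a permutation σ′ of [n + 1] to the pair
-- (σ′ n, σ) with σ a permutation of [n]; this is a bijection, n is a cycle minimum of σ′ iff σ′ n = n,
-- and all other cycle minima are those of σ.  In an s-tuple the chain condition forces the coordinates
-- with σ′ᵢ n = n to form an initial block; if it has length a, the other coordinates have n choices each.
-- So the number of tuples of [n + 1] with m cycles in total is ∑_{a ≤ s} n ^ (s ∸ a) times the number of
-- tuples of [n] with m ∸ a cycles, and unfolding this recursion gives Conv over the weights 0, 1, …, n.
-- Multiplying E_{k-1}(1, 1/2, …, 1/n) by (n !) ^ s turns each monomial ∏ (1/yᵢ) ^ aᵢ into ∏ yᵢ ^ (s ∸ aᵢ),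
-- i.e. gives Conv over the weights 1, …, n; the weight 0 only shifts the cycle count by s.

open import Algebra.Bundles using (CommutativeMonoid)
import Algebra.Properties.CommutativeSemigroup as CommSemigroupProperties
open import Data.Bool using (Bool; true; false; _∧_; _∨_; not; T; T?; if_then_else_)
open import Data.Bool.Properties using (T-∧; T-irrelevant; ∧-assoc; ∧-comm)
open import Data.Empty using (⊥; ⊥-elim)
open import Data.Fin as Fin using (Fin; toℕ; fromℕ; inject₁)
open import Data.Fin.Permutation.Components using (transpose)
open import Data.Fin.Properties
  using (fromℕ≢inject₁; inject₁-injective; pigeonhole; toℕ<n; toℕ-inject₁; toℕ-fromℕ; inject₁ℕ<)
  using (+↔⊎; *↔×; 0↔⊥; 1↔⊤)
import Data.Integer as ℤ
import Data.Integer.Properties as ℤP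
open import Data.List as L
  using (List; []; _∷_; _++_; _∷ʳ_; applyUpTo; upTo; allFin; concatMap; filter; zipWith; length)
open import Data.List.Membership.Propositional using (_∈_)
open import Data.List.Membership.Propositional.Properties using (∈-allFin; ∈-upTo⁺)
import Data.List.Properties as LP
open import Data.List.Relation.Unary.All as All using (All; []; _∷_)
import Data.List.Relation.Unary.All.Properties as AllP
open import Data.List.Relation.Unary.Any using (here; there)
open import Data.Nat as ℕ
  using (ℕ; zero; suc; _+_; _*_; _∸_; _^_; _≤_; _<_; _≥_; _≤ᵇ_; _≡ᵇ_; _≟_; _!; z≤n; s≤s)
open import Data.Nat.DivMod using (_%_; m≡m%n+[m/n]*n; m%n<n)
open import Data.Nat.ListAction using (sum; product)
open import Data.Nat.ListAction.Properties using (sum-++; product-++)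
open import Data.Nat.Properties hiding (_≟_)
open import Data.Product using (Σ; _×_; _,_; proj₁; proj₂; ∃-syntax)
open import Data.Product.Function.NonDependent.Propositional using (_×-↔_)
open import Data.Rational as ℚ using (ℚ; 1ℚ; toℚᵘ)
import Data.Rational.Properties as ℚP
import Data.Rational.Unnormalised as ℚᵘ
import Data.Rational.Unnormalised.Properties as ℚᵘP
open import Data.Sum using (_⊎_; inj₁; inj₂)
open import Data.Sum.Function.Propositional using (_⊎-↔_)
open import Data.Unit using (tt)
open import Data.Vec as V using (Vec; []; _∷_; tabulate)
open import Data.Vec.Properties using (lookup∘tabulate; tabulate∘lookup; tabulate-cong)
open import Data.Vec.Relation.Unary.All as VAll using ([]; _∷_)
open import Function using (_∘_; id)
open import Function.Bundles using (_↔_; mk↔ₛ′; Equivalence)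
open import Function.Definitions using (Injective)
open import Function.Properties.Inverse using (↔-refl; ↔-sym; ↔-trans)
open import Relation.Binary.PropositionalEquality
open import Relation.Nullary using (Dec; yes; no; does)
open import Relation.Nullary.Decidable using (⌊_⌋; toWitness; fromWitness; dec-true; dec-false)

open import Defs

open CommSemigroupProperties +-commutativeSemigroup using () renaming (interchange to +-interchange)
open CommSemigroupProperties (CommutativeMonoid.commutativeSemigroup ℚP.*-1-commutativeMonoid)
  using () renaming (interchange to *-interchangeℚ)

b2n : Bool → ℕ
b2n b = if b then 1 else 0

δ : ℕ → ℕ → ℕ
δ m o = b2n (o ≡ᵇ m)

δ-≡ : ∀ {m o} → o ≡ m → δ m o ≡ 1
δ-≡ {m} refl with m ≡ᵇ m | ≡⇒≡ᵇ m m refl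
... | true | _ = refl

δ-≢ : ∀ {m o} → o ≢ m → δ m o ≡ 0
δ-≢ {m} {o} o≢m with o ≡ᵇ m in eq
... | false = refl
... | true  = ⊥-elim (o≢m (≡ᵇ⇒≡ o m (subst T (sym eq) tt)))

δ-+ʳ : ∀ m o d → δ (m + d) (o + d) ≡ δ m o
δ-+ʳ m o d with o ≟ m
... | yes o≡m = trans (δ-≡ (cong (_+ d) o≡m)) (sym (δ-≡ o≡m))
... | no  o≢m = trans (δ-≢ (o≢m ∘ +-cancelʳ-≡ d o m)) (sym (δ-≢ o≢m))

sumBelow : ℕ → (ℕ → ℕ) → ℕ
sumBelow n f = sum (applyUpTo f n)

sumBelow-cong : ∀ n {f g} → (∀ a → f a ≡ g a) → sumBelow n f ≡ sumBelow n g
sumBelow-cong zero    f≗g = refl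
sumBelow-cong (suc n) f≗g = cong₂ _+_ (f≗g 0) (sumBelow-cong n (f≗g ∘ suc))

*-distribˡ-sumBelow : ∀ n c f → c * sumBelow n f ≡ sumBelow n (λ a → c * f a)
*-distribˡ-sumBelow zero    c f = *-zeroʳ c
*-distribˡ-sumBelow (suc n) c f =
  trans (*-distribˡ-+ c (f 0) _) (cong (c * f 0 +_) (*-distribˡ-sumBelow n c (f ∘ suc)))

sumBelow-+ : ∀ n f g → sumBelow n (λ a → f a + g a) ≡ sumBelow n f + sumBelow n g
sumBelow-+ zero    f g = refl
sumBelow-+ (suc n) f g = trans (cong (f 0 + g 0 +_) (sumBelow-+ n (f ∘ suc) (g ∘ suc)))
  (+-interchange (f 0) (g 0) _ _)

sumBelow-≡0 : ∀ n f → (∀ a → a < n → f a ≡ 0) → sumBelow n f ≡ 0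
sumBelow-≡0 zero    f f≡0 = refl
sumBelow-≡0 (suc n) f f≡0 =
  cong₂ _+_ (f≡0 0 (s≤s z≤n)) (sumBelow-≡0 n (f ∘ suc) (λ a a<n → f≡0 (suc a) (s≤s a<n)))

sumBelow-comm : ∀ m n (f : ℕ → ℕ → ℕ) →
  sumBelow m (λ a → sumBelow n (f a)) ≡ sumBelow n (λ b → sumBelow m (λ a → f a b))
sumBelow-comm zero    n f = sym (sumBelow-≡0 n _ (λ _ _ → refl))
sumBelow-comm (suc m) n f = trans (cong (sumBelow n (f 0) +_) (sumBelow-comm m n (f ∘ suc)))
  (sym (sumBelow-+ n (f 0) _))

sumBelow-suc : ∀ n f → sumBelow (suc n) f ≡ sumBelow n f + f n
sumBelow-suc zero    f = +-comm (f 0) 0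
sumBelow-suc (suc n) f = trans (cong (f 0 +_) (sumBelow-suc n (f ∘ suc))) (sym (+-assoc (f 0) _ _))

module _ (s : ℕ) where

  weight : ℕ → ℕ → ℕ
  weight y a = y ^ (s ∸ a)

  -- Conv ys h o = ∑ (∏ᵢ yᵢ ^ (s ∸ aᵢ)) · h (o + ∑ᵢ aᵢ), summed over all tuples a ∈ [0, s] ^ |ys|.
  Conv : List ℕ → (ℕ → ℕ) → ℕ → ℕ
  Conv []       h o = h o
  Conv (y ∷ ys) h o = sumBelow (suc s) (λ a → weight y a * Conv ys h (o + a))

  Conv-cong : ∀ ys {h h′} → (∀ o → h o ≡ h′ o) → ∀ o → Conv ys h o ≡ Conv ys h′ o
  Conv-cong []       h≗h′ o = h≗h′ o
  Conv-cong (y ∷ ys) h≗h′ o =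
    sumBelow-cong (suc s) (λ a → cong (weight y a *_) (Conv-cong ys h≗h′ (o + a)))

  Conv-comm : ∀ x y ys h o → Conv (x ∷ y ∷ ys) h o ≡ Conv (y ∷ x ∷ ys) h o
  Conv-comm x y ys h o = begin
    ∑ (λ a → weight x a * ∑ (λ b → weight y b * C (o + a + b)))
      ≡⟨ ∑-cong (λ a → *-distribˡ-sumBelow (suc s) (weight x a) λ b → weight y b * C (o + a + b)) ⟩
    ∑ (λ a → ∑ (λ b → weight x a * (weight y b * C (o + a + b))))
      ≡⟨ sumBelow-comm (suc s) (suc s) (λ a b → weight x a * (weight y b * C (o + a + b))) ⟩
    ∑ (λ b → ∑ (λ a → weight x a * (weight y b * C (o + a + b))))
      ≡⟨ ∑-cong (λ b → ∑-cong (λ a → exchange a b)) ⟩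
    ∑ (λ b → ∑ (λ a → weight y b * (weight x a * C (o + b + a))))
      ≡⟨ ∑-cong (λ b → sym (*-distribˡ-sumBelow (suc s) (weight y b) λ a → weight x a * C (o + b + a))) ⟩
    ∑ (λ b → weight y b * ∑ (λ a → weight x a * C (o + b + a))) ∎
    where
    open ≡-Reasoning
    open CommSemigroupProperties *-commutativeSemigroup using (x∙yz≈y∙xz)
    C = Conv ys h
    ∑ = sumBelow (suc s)
    ∑-cong = sumBelow-cong (suc s)
    exchange : ∀ a b →
      weight x a * (weight y b * C (o + a + b)) ≡ weight y b * (weight x a * C (o + b + a))
    exchange a b rewrite +-assoc o a b | +-comm a b | sym (+-assoc o b a) =
      x∙yz≈y∙xz (weight x a) (weight y b) _

  Conv-∷ʳ : ∀ ys y h o → Conv (ys ∷ʳ y) h o ≡ Conv (y ∷ ys) h o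
  Conv-∷ʳ []       y h o = refl
  Conv-∷ʳ (z ∷ ys) y h o = trans
    (sumBelow-cong (suc s) (λ a → cong (weight z a *_) (Conv-∷ʳ ys y h (o + a))))
    (Conv-comm z y ys h o)

  Conv-shift : ∀ ys h o d → Conv ys h (o + d) ≡ Conv ys (λ o′ → h (o′ + d)) o
  Conv-shift []       h o d = refl
  Conv-shift (y ∷ ys) h o d = sumBelow-cong (suc s) λ a → cong (weight y a *_) (begin
    Conv ys h (o + d + a)                 ≡⟨ cong (Conv ys h) (+-assoc o d a) ⟩
    Conv ys h (o + (d + a))               ≡⟨ cong (λ e → Conv ys h (o + e)) (+-comm d a) ⟩
    Conv ys h (o + (a + d))               ≡⟨ cong (Conv ys h) (sym (+-assoc o a d)) ⟩
    Conv ys h (o + a + d)                 ≡⟨ Conv-shift ys h (o + a) d ⟩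
    Conv ys (λ o′ → h (o′ + d)) (o + a)   ∎)
    where open ≡-Reasoning

  Conv-≡0 : ∀ ys h o → (∀ o′ → o ≤ o′ → h o′ ≡ 0) → Conv ys h o ≡ 0
  Conv-≡0 []       h o h≡0 = h≡0 o ≤-refl
  Conv-≡0 (y ∷ ys) h o h≡0 = sumBelow-≡0 (suc s) _ λ a _ → trans
    (cong (weight y a *_) (Conv-≡0 ys h (o + a) (λ o′ o+a≤o′ → h≡0 o′ (m+n≤o⇒m≤o o o+a≤o′))))
    (*-zeroʳ (weight y a))

  -- A zero weight forces the full exponent a = s, since 0 ^ (s ∸ a) = 0 for a < s.
  Conv-0∷ : ∀ ys h o → Conv (0 ∷ ys) h o ≡ Conv ys h (o + s)
  Conv-0∷ ys h o = begin
    sumBelow (suc s) (λ a → weight 0 a * Conv ys h (o + a))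
      ≡⟨ sumBelow-suc s _ ⟩
    sumBelow s (λ a → weight 0 a * Conv ys h (o + a)) + weight 0 s * Conv ys h (o + s)
      ≡⟨ cong₂ _+_ (sumBelow-≡0 s _ λ a a<s →
                      cong (_* Conv ys h (o + a)) (0^-nonZero (m>n⇒m∸n≢0 a<s)))
                   (cong (λ e → 0 ^ e * Conv ys h (o + s)) (n∸n≡0 s)) ⟩
    1 * Conv ys h (o + s)
      ≡⟨ *-identityˡ _ ⟩
    Conv ys h (o + s) ∎
    where
    open ≡-Reasoning
    0^-nonZero : ∀ {e} → e ≢ 0 → 0 ^ e ≡ 0
    0^-nonZero {zero}  e≢0 = ⊥-elim (e≢0 refl)
    0^-nonZero {suc e} _   = refl

allL⁻ : ∀ {A : Set} (p : A → Bool) {xs x} → T (allL p xs) → x ∈ xs → T (p x)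
allL⁻ p {x ∷ xs} t (here refl) = proj₁ (Equivalence.to (T-∧ {p x}) t)
allL⁻ p {y ∷ xs} t (there x∈) = allL⁻ p (proj₂ (Equivalence.to (T-∧ {p y}) t)) x∈

allL⁺ : ∀ {A : Set} (p : A → Bool) xs → (∀ {x} → x ∈ xs → T (p x)) → T (allL p xs)
allL⁺ p []       all-p = tt
allL⁺ p (x ∷ xs) all-p = Equivalence.from (T-∧ {p x}) (all-p (here refl) , allL⁺ p xs (all-p ∘ there))

T-injective : ∀ {a b} → (T a → T b) → (T b → T a) → a ≡ b
T-injective {false} {false} _ _ = refl
T-injective {false} {true}  _ g = ⊥-elim (g tt)
T-injective {true}  {false} f _ = ⊥-elim (f tt)
T-injective {true}  {true}  _ _ = refl

data LastView {n : ℕ} : Fin (suc n) → Set where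
  last  : LastView (fromℕ n)
  inner : (j : Fin n) → LastView (inject₁ j)

lastView : ∀ {n} (i : Fin (suc n)) → LastView i
lastView {zero}  Fin.zero    = last
lastView {suc n} Fin.zero    = inner Fin.zero
lastView {suc n} (Fin.suc i) with lastView i
... | last    = last
... | inner j = inner (Fin.suc j)

lastView-fromℕ : ∀ n → lastView (fromℕ n) ≡ last
lastView-fromℕ zero = refl
lastView-fromℕ (suc n) rewrite lastView-fromℕ n = refl

lastView-inject₁ : ∀ {n} (j : Fin n) → lastView (inject₁ j) ≡ inner j
lastView-inject₁ {suc n} Fin.zero    = refl
lastView-inject₁ {suc n} (Fin.suc j) rewrite lastView-inject₁ j = refl

isLast : ∀ {n} → Fin (suc n) → Bool
isLast i with lastView i
... | last    = true
... | inner _ = false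

isLast-fromℕ : ∀ n → isLast (fromℕ n) ≡ true
isLast-fromℕ n rewrite lastView-fromℕ n = refl

isLast-inject₁ : ∀ {n} (j : Fin n) → isLast (inject₁ j) ≡ false
isLast-inject₁ j rewrite lastView-inject₁ j = refl

swapLast : ∀ {n} → Fin (suc n) → Fin (suc n) → Fin (suc n)
swapLast {n} c = transpose c (fromℕ n)

swapLast-c : ∀ {n} (c : Fin (suc n)) → swapLast c c ≡ fromℕ n
swapLast-c c rewrite dec-true (c Fin.≟ c) refl = refl

swapLast-last : ∀ {n} (c : Fin (suc n)) → swapLast c (fromℕ n) ≡ c
swapLast-last {n} c with fromℕ n Fin.≟ c
... | yes L≡c = L≡c
... | no  _   rewrite dec-true (fromℕ n Fin.≟ fromℕ n) refl = refl

swapLast-other : ∀ {n} (c x : Fin (suc n)) → x ≢ c → x ≢ fromℕ n → swapLast c x ≡ x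
swapLast-other {n} c x x≢c x≢L
  rewrite dec-false (x Fin.≟ c) x≢c | dec-false (x Fin.≟ fromℕ n) x≢L = refl

swapLast-involutive : ∀ {n} (c x : Fin (suc n)) → swapLast c (swapLast c x) ≡ x
swapLast-involutive {n} c x = byCases (x Fin.≟ c) (x Fin.≟ fromℕ n)
  where
  byCases : Dec (x ≡ c) → Dec (x ≡ fromℕ n) → swapLast c (swapLast c x) ≡ x
  byCases (yes x≡c) _ = subst (λ y → swapLast c (swapLast c y) ≡ y) (sym x≡c)
    (trans (cong (swapLast c) (swapLast-c c)) (swapLast-last c))
  byCases (no _) (yes x≡L) = subst (λ y → swapLast c (swapLast c y) ≡ y) (sym x≡L)
    (trans (cong (swapLast c) (swapLast-last c)) (swapLast-c c))
  byCases (no x≢c) (no x≢L) =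
    trans (cong (swapLast c) (swapLast-other c x x≢c x≢L)) (swapLast-other c x x≢c x≢L)

swapLast-injective : ∀ {n} (c : Fin (suc n)) → Injective _≡_ _≡_ (swapLast c)
swapLast-injective c {x} {y} e =
  trans (sym (swapLast-involutive c x)) (trans (cong (swapLast c) e) (swapLast-involutive c y))

extendLast : ∀ {n} → (Fin n → Fin n) → Fin (suc n) → Fin (suc n)
extendLast {n} f i with lastView i
... | last    = fromℕ n
... | inner j = inject₁ (f j)

extendLast-last : ∀ {n} (f : Fin n → Fin n) → extendLast f (fromℕ n) ≡ fromℕ n
extendLast-last {n} f rewrite lastView-fromℕ n = refl

extendLast-inject₁ : ∀ {n} (f : Fin n → Fin n) j → extendLast f (inject₁ j) ≡ inject₁ (f j)
extendLast-inject₁ f j rewrite lastView-inject₁ j = refl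

extendLast-injective : ∀ {n} (f : Fin n → Fin n) →
  Injective _≡_ _≡_ f → Injective _≡_ _≡_ (extendLast f)
extendLast-injective f f-inj {i} {j} e with lastView i | lastView j
... | last    | last    = refl
... | last    | inner _ = ⊥-elim (fromℕ≢inject₁ e)
... | inner _ | last    = ⊥-elim (fromℕ≢inject₁ (sym e))
... | inner _ | inner _ = cong inject₁ (f-inj (inject₁-injective e))

lower₁Or : ∀ {n} → Fin (suc n) → Fin n → Fin n
lower₁Or y d with lastView y
... | last    = d
... | inner j = j

lower₁Or-inject₁ : ∀ {n} (j d : Fin n) → lower₁Or (inject₁ j) d ≡ j
lower₁Or-inject₁ j d rewrite lastView-inject₁ j = refl

IsPerm : ∀ {n} → Perm-data n → Set
IsPerm σ = Injective _≡_ _≡_ (app σ)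

isPerm⇒IsPerm : ∀ {n} (σ : Perm-data n) → T (isPerm σ) → IsPerm σ
isPerm⇒IsPerm {n} σ t {i} {j} e with allL⁻ _ (allL⁻ _ t (∈-allFin i)) (∈-allFin j)
... | u with app σ i Fin.≟ app σ j
...   | no  ne = ⊥-elim (ne e)
...   | yes _  = toWitness u

IsPerm⇒isPerm : ∀ {n} (σ : Perm-data n) → IsPerm σ → T (isPerm σ)
IsPerm⇒isPerm {n} σ σ-inj = allL⁺ _ (allFin n) (λ {i} _ → allL⁺ _ (allFin n) (λ {j} _ → pair i j))
  where
  pair : ∀ i j → T (not ⌊ app σ i Fin.≟ app σ j ⌋ ∨ ⌊ i Fin.≟ j ⌋)
  pair i j with app σ i Fin.≟ app σ j
  ... | no  _ = tt
  ... | yes e = fromWitness (σ-inj e)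

-- Inserts n into the cycle of σ through c, just before c (as a new fixed point when c = n).
insertLast : ∀ {n} → Fin (suc n) → Perm-data n → Perm-data (suc n)
insertLast c σ = tabulate (swapLast c ∘ extendLast (app σ))

deleteLast : ∀ {n} → Perm-data (suc n) → Perm-data n
deleteLast {n} σ′ = tabulate λ x → lower₁Or (swapLast (app σ′ (fromℕ n)) (app σ′ (inject₁ x))) x

app-insertLast : ∀ {n} c (σ : Perm-data n) i →
  app (insertLast c σ) i ≡ swapLast c (extendLast (app σ) i)
app-insertLast c σ = lookup∘tabulate (swapLast c ∘ extendLast (app σ))

app-deleteLast : ∀ {n} (σ′ : Perm-data (suc n)) x →
  app (deleteLast σ′) x ≡ lower₁Or (swapLast (app σ′ (fromℕ n)) (app σ′ (inject₁ x))) x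
app-deleteLast {n} σ′ =
  lookup∘tabulate λ x → lower₁Or (swapLast (app σ′ (fromℕ n)) (app σ′ (inject₁ x))) x

Perm-data-ext : ∀ {n} {σ τ : Perm-data n} → (∀ i → app σ i ≡ app τ i) → σ ≡ τ
Perm-data-ext {σ = σ} {τ} σ≗τ =
  trans (sym (tabulate∘lookup σ)) (trans (tabulate-cong σ≗τ) (tabulate∘lookup τ))

insertLast-last : ∀ {n} c (σ : Perm-data n) → app (insertLast c σ) (fromℕ n) ≡ c
insertLast-last c σ =
  trans (app-insertLast c σ _) (trans (cong (swapLast c) (extendLast-last _)) (swapLast-last c))

insertLast-IsPerm : ∀ {n} c (σ : Perm-data n) → IsPerm σ → IsPerm (insertLast c σ)
insertLast-IsPerm c σ σ-inj {i} {j} e = extendLast-injective (app σ) σ-inj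
  (swapLast-injective c (trans (sym (app-insertLast c σ i)) (trans e (app-insertLast c σ j))))

deleteLast-insertLast : ∀ {n} c (σ : Perm-data n) → deleteLast (insertLast c σ) ≡ σ
deleteLast-insertLast {n} c σ = Perm-data-ext λ x → begin
  app (deleteLast (insertLast c σ)) x
    ≡⟨ app-deleteLast (insertLast c σ) x ⟩
  lower₁Or (swapLast (app (insertLast c σ) (fromℕ n)) (app (insertLast c σ) (inject₁ x))) x
    ≡⟨ cong₂ (λ a b → lower₁Or (swapLast a b) x) (insertLast-last c σ) (app-insertLast c σ _) ⟩
  lower₁Or (swapLast c (swapLast c (extendLast (app σ) (inject₁ x)))) x
    ≡⟨ cong (λ a → lower₁Or a x) (trans (swapLast-involutive c _) (extendLast-inject₁ _ x)) ⟩
  lower₁Or (inject₁ (app σ x)) x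
    ≡⟨ lower₁Or-inject₁ _ x ⟩
  app σ x ∎
  where open ≡-Reasoning

module _ {n} (σ′ : Perm-data (suc n)) (σ′-inj : IsPerm σ′) where

  private
    c = app σ′ (fromℕ n)

  -- swapLast c ∘ σ′ fixes the last element, so on the other elements it is inject₁ ∘ deleteLast σ′.
  inject₁-deleteLast : ∀ x → inject₁ (app (deleteLast σ′) x) ≡ swapLast c (app σ′ (inject₁ x))
  inject₁-deleteLast x = helper _ refl
    where
    helper : ∀ y → swapLast c (app σ′ (inject₁ x)) ≡ y → inject₁ (app (deleteLast σ′) x) ≡ y
    helper y e with lastView y
    ... | last    =
      ⊥-elim (fromℕ≢inject₁ (sym (σ′-inj (swapLast-injective c (trans e (sym (swapLast-c c)))))))
    ... | inner j = cong inject₁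
      (trans (app-deleteLast σ′ x) (trans (cong (λ a → lower₁Or a x) e) (lower₁Or-inject₁ j x)))

  deleteLast-IsPerm : IsPerm (deleteLast σ′)
  deleteLast-IsPerm {x} {y} e = inject₁-injective (σ′-inj (swapLast-injective c
    (trans (sym (inject₁-deleteLast x)) (trans (cong inject₁ e) (inject₁-deleteLast y)))))

  insertLast-deleteLast : insertLast c (deleteLast σ′) ≡ σ′
  insertLast-deleteLast = Perm-data-ext λ i → trans (app-insertLast c (deleteLast σ′) i)
    (trans (cong (swapLast c) (extended i)) (swapLast-involutive c (app σ′ i)))
    where
    extended : ∀ i → extendLast (app (deleteLast σ′)) i ≡ swapLast c (app σ′ i)
    extended i with lastView i
    ... | last    = sym (swapLast-c c)
    ... | inner x = inject₁-deleteLast x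

iter-+ : ∀ {n} (σ : Perm-data n) a b i → iter σ (a + b) i ≡ iter σ a (iter σ b i)
iter-+ σ zero    b i = refl
iter-+ σ (suc a) b i = cong (app σ) (iter-+ σ a b i)

iter-injective : ∀ {n} (σ : Perm-data n) → IsPerm σ → ∀ a → Injective _≡_ _≡_ (iter σ a)
iter-injective σ σ-inj zero    e = e
iter-injective σ σ-inj (suc a) e = iter-injective σ σ-inj a (σ-inj e)

iter-*-period : ∀ {n} (σ : Perm-data n) d i → iter σ d i ≡ i → ∀ m → iter σ (m * d) i ≡ i
iter-*-period σ d i σᵈi≡i zero    = refl
iter-*-period σ d i σᵈi≡i (suc m) =
  trans (iter-+ σ d (m * d) i) (trans (cong (iter σ d) (iter-*-period σ d i σᵈi≡i m)) σᵈi≡i)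

-- By pigeonhole two of i, σ i, …, σⁿ i coincide; injectivity turns this into a return to i.
iter-period : ∀ {n} (σ : Perm-data n) → IsPerm σ → ∀ i →
  ∃[ d ] suc d ≤ n × iter σ (suc d) i ≡ i
iter-period {n} σ σ-inj i with pigeonhole (n<1+n n) (λ (t : Fin (suc n)) → iter σ (toℕ t) i)
... | p , q , p<q , collision = d , d<n , iter-injective σ σ-inj (toℕ p) returns
  where
  d = ℕ.pred (toℕ q ∸ toℕ p)
  suc-d : suc d ≡ toℕ q ∸ toℕ p
  suc-d = suc-pred (toℕ q ∸ toℕ p) {{ ℕ.>-nonZero (m<n⇒0<n∸m p<q) }}
  d<n : suc d ≤ n
  d<n = subst (_≤ n) (sym suc-d) (≤-trans (m∸n≤m (toℕ q) (toℕ p)) (≤-pred (toℕ<n q)))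
  returns : iter σ (toℕ p) (iter σ (suc d) i) ≡ iter σ (toℕ p) i
  returns = begin
    iter σ (toℕ p) (iter σ (suc d) i)         ≡⟨ sym (iter-+ σ (toℕ p) (suc d) i) ⟩
    iter σ (toℕ p + suc d) i                  ≡⟨ cong (λ e → iter σ (toℕ p + e) i) suc-d ⟩
    iter σ (toℕ p + (toℕ q ∸ toℕ p)) i        ≡⟨ cong (λ e → iter σ e i) (m+[n∸m]≡n (<⇒≤ p<q)) ⟩
    iter σ (toℕ q) i                          ≡⟨ sym collision ⟩
    iter σ (toℕ p) i                          ∎
    where open ≡-Reasoning

iter-mod : ∀ {n} (σ : Perm-data n) → IsPerm σ → ∀ i t →
  ∃[ t′ ] t′ < n × iter σ t i ≡ iter σ t′ i
iter-mod {n} σ σ-inj i t with iter-period σ σ-inj i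
... | d , d<n , period = t % suc d , ≤-trans (m%n<n t (suc d)) d<n , (begin
  iter σ t i                                    ≡⟨ cong (λ e → iter σ e i) (m≡m%n+[m/n]*n t (suc d)) ⟩
  iter σ (t % suc d + q * suc d) i              ≡⟨ iter-+ σ (t % suc d) _ i ⟩
  iter σ (t % suc d) (iter σ (q * suc d) i)     ≡⟨ cong (iter σ r) (iter-*-period σ (suc d) i period q) ⟩
  iter σ (t % suc d) i                          ∎)
  where
  open ≡-Reasoning
  q = t ℕ./ suc d
  r = t % suc d

OrbitMin : ∀ {n} → Perm-data n → Fin n → Set
OrbitMin σ i = ∀ t → toℕ i ≤ toℕ (iter σ t i)

-- isCycleMin only inspects σᵗ i for t ≤ n; iter-mod shows that this suffices.
isCycleMin⇒OrbitMin : ∀ {n} (σ : Perm-data n) → IsPerm σ → ∀ i →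
  T (isCycleMin σ i) → OrbitMin σ i
isCycleMin⇒OrbitMin {n} σ σ-inj i isMin t with iter-mod σ σ-inj i t
... | t′ , t′<n , σᵗi≡σᵗ′i = subst (λ z → toℕ i ≤ toℕ z) (sym σᵗi≡σᵗ′i)
  (≤ᵇ⇒≤ _ _ (allL⁻ (λ t → toℕ i ≤ᵇ toℕ (iter σ t i)) isMin (∈-upTo⁺ (m≤n⇒m≤1+n t′<n))))

OrbitMin⇒isCycleMin : ∀ {n} (σ : Perm-data n) i → OrbitMin σ i → T (isCycleMin σ i)
OrbitMin⇒isCycleMin {n} σ i isMin = allL⁺ _ (upTo (suc n)) (λ {t} _ → ≤⇒≤ᵇ (isMin t))

module InsertLast {n} (c : Fin (suc n)) (σ : Perm-data n) (σ-inj : IsPerm σ) where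

  private
    σ′ = insertLast c σ
    L = fromℕ n

  step-inject₁ : ∀ y →
    (inject₁ (app σ y) ≡ c × app σ′ (inject₁ y) ≡ L) ⊎ app σ′ (inject₁ y) ≡ inject₁ (app σ y)
  step-inject₁ y with inject₁ (app σ y) Fin.≟ c
  ... | yes σy≡c = inj₁ (σy≡c , (begin
    app σ′ (inject₁ y)                           ≡⟨ app-insertLast c σ (inject₁ y) ⟩
    swapLast c (extendLast (app σ) (inject₁ y))  ≡⟨ cong (swapLast c) (extendLast-inject₁ (app σ) y) ⟩
    swapLast c (inject₁ (app σ y))               ≡⟨ cong (swapLast c) σy≡c ⟩
    swapLast c c                                 ≡⟨ swapLast-c c ⟩
    L                                            ∎))
    where open ≡-Reasoning
  ... | no  σy≢c = inj₂ (begin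
    app σ′ (inject₁ y)                           ≡⟨ app-insertLast c σ (inject₁ y) ⟩
    swapLast c (extendLast (app σ) (inject₁ y))  ≡⟨ cong (swapLast c) (extendLast-inject₁ (app σ) y) ⟩
    swapLast c (inject₁ (app σ y))               ≡⟨ swapLast-other c _ σy≢c (fromℕ≢inject₁ ∘ sym) ⟩
    inject₁ (app σ y)                            ∎)
    where open ≡-Reasoning

  -- The σ′-orbit of inject₁ x consists of the σ-orbit of x, plus L when c lies on that orbit.
  InOrbit : Fin n → Fin (suc n) → Set
  InOrbit x z = (∃[ u ] z ≡ inject₁ (iter σ u x)) ⊎ (z ≡ L × ∃[ u ] c ≡ inject₁ (iter σ u x))

  orbit⊆ : ∀ x t → InOrbit x (iter σ′ t (inject₁ x))
  orbit⊆ x zero = inj₁ (0 , refl)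
  orbit⊆ x (suc t) with orbit⊆ x t
  ... | inj₁ (u , e) rewrite e with step-inject₁ (iter σ u x)
  ...   | inj₁ (σy≡c , e′) = inj₂ (e′ , suc u , sym σy≡c)
  ...   | inj₂ e′          = inj₁ (suc u , e′)
  orbit⊆ x (suc t) | inj₂ (e , u , c≡) rewrite e = inj₁ (u , trans (insertLast-last c σ) c≡)

  orbit⊇ : ∀ x u → ∃[ t ] iter σ′ t (inject₁ x) ≡ inject₁ (iter σ u x)
  orbit⊇ x zero = 0 , refl
  orbit⊇ x (suc u) with orbit⊇ x u
  ... | t , e with step-inject₁ (iter σ u x)
  ...   | inj₁ (σy≡c , e′) = suc (suc t) , trans (cong (app σ′) (trans (cong (app σ′) e) e′))
                                                 (trans (insertLast-last c σ) (sym σy≡c))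
  ...   | inj₂ e′          = suc t , trans (cong (app σ′) e) e′

  isCycleMin-inject₁ : ∀ x → isCycleMin σ′ (inject₁ x) ≡ isCycleMin σ x
  isCycleMin-inject₁ x = T-injective
    (λ isMin′ → OrbitMin⇒isCycleMin σ x λ u → let (t , e) = orbit⊇ x u in
      subst₂ _≤_ (toℕ-inject₁ x) (trans (cong toℕ e) (toℕ-inject₁ _))
        (isCycleMin⇒OrbitMin σ′ (insertLast-IsPerm c σ σ-inj) (inject₁ x) isMin′ t))
    (λ isMin → OrbitMin⇒isCycleMin σ′ (inject₁ x) λ t →
      bound (iter σ′ t (inject₁ x)) (orbit⊆ x t) (isCycleMin⇒OrbitMin σ σ-inj x isMin))
    where
    bound : ∀ z → InOrbit x z → OrbitMin σ x → toℕ (inject₁ x) ≤ toℕ z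
    bound z (inj₁ (u , e)) isMin rewrite e =
      subst₂ _≤_ (sym (toℕ-inject₁ x)) (sym (toℕ-inject₁ _)) (isMin u)
    bound z (inj₂ (e , _)) _     rewrite e =
      subst (toℕ (inject₁ x) ≤_) (sym (toℕ-fromℕ n)) (<⇒≤ (inject₁ℕ< x))

  isCycleMin-last : isCycleMin σ′ L ≡ isLast c
  isCycleMin-last with lastView c
  ... | last = T-injective (λ _ → tt) λ _ →
    OrbitMin⇒isCycleMin σ′ L (λ t → subst (λ z → toℕ L ≤ toℕ z) (sym (fixed t)) ≤-refl)
    where
    fixed : ∀ t → iter σ′ t L ≡ L
    fixed zero    = refl
    fixed (suc t) = trans (cong (app σ′) (fixed t)) (insertLast-last c σ)
  ... | inner v = T-injective (λ isMin → ⊥-elim (<⇒≱ v<L (σ′L≥L isMin))) ⊥-elim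
    where
    v<L : toℕ (inject₁ v) < toℕ L
    v<L = subst₂ _<_ (sym (toℕ-inject₁ v)) (sym (toℕ-fromℕ n)) (toℕ<n v)
    σ′L≥L : T (isCycleMin σ′ L) → toℕ L ≤ toℕ (inject₁ v)
    σ′L≥L isMin = subst (λ z → toℕ L ≤ toℕ z) (insertLast-last _ σ)
      (≤ᵇ⇒≤ _ _ (allL⁻ (λ t → toℕ L ≤ᵇ toℕ (iter σ′ t L)) isMin
        (∈-upTo⁺ {n = 2 + n} {i = 1} (s≤s (s≤s z≤n)))))

countTrue : ∀ {A : Set} → (A → Bool) → List A → ℕ
countTrue p []       = 0
countTrue p (x ∷ xs) = b2n (p x) + countTrue p xs

length-filter-T : ∀ {A : Set} (p : A → Bool) xs → length (filter (T? ∘ p) xs) ≡ countTrue p xs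
length-filter-T p []       = refl
length-filter-T p (x ∷ xs) with p x
... | true  = cong suc (length-filter-T p xs)
... | false = length-filter-T p xs

countTrue-tabulate-cong : ∀ {A B : Set} n (p : A → Bool) (q : B → Bool) (f : Fin n → A) (g : Fin n → B) →
  (∀ i → p (f i) ≡ q (g i)) → countTrue p (L.tabulate f) ≡ countTrue q (L.tabulate g)
countTrue-tabulate-cong zero    p q f g pf≗qg = refl
countTrue-tabulate-cong (suc n) p q f g pf≗qg = cong₂ (λ a b → b2n a + b) (pf≗qg Fin.zero)
  (countTrue-tabulate-cong n p q (f ∘ Fin.suc) (g ∘ Fin.suc) (pf≗qg ∘ Fin.suc))

countTrue-tabulate-last : ∀ {A : Set} n (p : A → Bool) (f : Fin (suc n) → A) →
  countTrue p (L.tabulate f) ≡ countTrue p (L.tabulate (f ∘ inject₁)) + b2n (p (f (fromℕ n)))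
countTrue-tabulate-last zero    p f = +-comm (b2n (p (f Fin.zero))) 0
countTrue-tabulate-last (suc n) p f = trans
  (cong (b2n (p (f Fin.zero)) +_) (countTrue-tabulate-last n p (f ∘ Fin.suc)))
  (sym (+-assoc (b2n (p (f Fin.zero))) _ _))

allL-tabulate-cong : ∀ {A B : Set} n (p : A → Bool) (q : B → Bool) (f : Fin n → A) (g : Fin n → B) →
  (∀ i → p (f i) ≡ q (g i)) → allL p (L.tabulate f) ≡ allL q (L.tabulate g)
allL-tabulate-cong zero    p q f g pf≗qg = refl
allL-tabulate-cong (suc n) p q f g pf≗qg =
  cong₂ _∧_ (pf≗qg Fin.zero) (allL-tabulate-cong n p q (f ∘ Fin.suc) (g ∘ Fin.suc) (pf≗qg ∘ Fin.suc))

allL-tabulate-last : ∀ {A : Set} n (p : A → Bool) (f : Fin (suc n) → A) →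
  allL p (L.tabulate f) ≡ allL p (L.tabulate (f ∘ inject₁)) ∧ p (f (fromℕ n))
allL-tabulate-last zero    p f = ∧-comm (p (f Fin.zero)) true
allL-tabulate-last (suc n) p f = trans
  (cong (p (f Fin.zero) ∧_) (allL-tabulate-last n p (f ∘ Fin.suc)))
  (sym (∧-assoc (p (f Fin.zero)) _ _))

numCycleMins-insertLast : ∀ {n} c (σ : Perm-data n) → IsPerm σ →
  numCycleMins (insertLast c σ) ≡ numCycleMins σ + b2n (isLast c)
numCycleMins-insertLast {n} c σ σ-inj = begin
  numCycleMins σ′
    ≡⟨ length-filter-T (isCycleMin σ′) (allFin (suc n)) ⟩
  countTrue (isCycleMin σ′) (L.tabulate id)
    ≡⟨ countTrue-tabulate-last n (isCycleMin σ′) id ⟩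
  countTrue (isCycleMin σ′) (L.tabulate inject₁) + b2n (isCycleMin σ′ (fromℕ n))
    ≡⟨ cong₂ _+_ (countTrue-tabulate-cong n _ _ inject₁ id (InsertLast.isCycleMin-inject₁ c σ σ-inj))
                 (cong b2n (InsertLast.isCycleMin-last c σ σ-inj)) ⟩
  countTrue (isCycleMin σ) (L.tabulate id) + b2n (isLast c)
    ≡⟨ cong (_+ b2n (isLast c)) (sym (length-filter-T (isCycleMin σ) (allFin n))) ⟩
  numCycleMins σ + b2n (isLast c) ∎
  where
  open ≡-Reasoning
  σ′ = insertLast c σ

minSubset-insertLast : ∀ {n} c d (τ σ : Perm-data n) → IsPerm τ → IsPerm σ →
  minSubset (insertLast d τ) (insertLast c σ) ≡ minSubset τ σ ∧ (not (isLast d) ∨ isLast c)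
minSubset-insertLast {n} c d τ σ τ-inj σ-inj = begin
  allL P′ (L.tabulate id)
    ≡⟨ allL-tabulate-last n P′ id ⟩
  allL P′ (L.tabulate inject₁) ∧ P′ (fromℕ n)
    ≡⟨ cong₂ _∧_ (allL-tabulate-cong n P′ P inject₁ id λ i → cong₂ implies
                    (InsertLast.isCycleMin-inject₁ d τ τ-inj i) (InsertLast.isCycleMin-inject₁ c σ σ-inj i))
                 (cong₂ implies (InsertLast.isCycleMin-last d τ τ-inj) (InsertLast.isCycleMin-last c σ σ-inj)) ⟩
  allL P (L.tabulate id) ∧ (not (isLast d) ∨ isLast c) ∎
  where
  open ≡-Reasoning
  implies = λ a b → not a ∨ b
  P′ = λ i → implies (isCycleMin (insertLast d τ) i) (isCycleMin (insertLast c σ) i)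
  P  = λ i → implies (isCycleMin τ i) (isCycleMin σ i)

-- isLast c₁, …, isLast cₛ is a block of trues followed by falses; b says whether a true is still allowed.
lastsFirst : ∀ {n s} → Bool → Vec (Fin (suc n)) s → Bool
lastsFirst b []       = true
lastsFirst b (c ∷ cs) = (b ∨ not (isLast c)) ∧ lastsFirst (isLast c) cs

countLasts : ∀ {n s} → Vec (Fin (suc n)) s → ℕ
countLasts []       = 0
countLasts (c ∷ cs) = b2n (isLast c) + countLasts cs

insertLasts : ∀ {n s} → Vec (Fin (suc n)) s → Vec (Perm-data n) s → Vec (Perm-data (suc n)) s
insertLasts = V.zipWith insertLast

lastImages : ∀ {n s} → Vec (Perm-data (suc n)) s → Vec (Fin (suc n)) s
lastImages {n} = V.map (λ σ′ → app σ′ (fromℕ n))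

deleteLasts : ∀ {n s} → Vec (Perm-data (suc n)) s → Vec (Perm-data n) s
deleteLasts = V.map deleteLast

allPerms⇒All : ∀ {n s} (σs : Vec (Perm-data n) s) → T (allPerms σs) → VAll.All IsPerm σs
allPerms⇒All []       _ = []
allPerms⇒All (σ ∷ σs) t with Equivalence.to (T-∧ {isPerm σ}) t
... | σ-perm , σs-perm = isPerm⇒IsPerm σ σ-perm ∷ allPerms⇒All σs σs-perm

All⇒allPerms : ∀ {n s} {σs : Vec (Perm-data n) s} → VAll.All IsPerm σs → T (allPerms σs)
All⇒allPerms []                             = tt
All⇒allPerms {σs = σ ∷ _} (σ-inj ∷ σs-inj) =
  Equivalence.from (T-∧ {isPerm σ}) (IsPerm⇒isPerm σ σ-inj , All⇒allPerms σs-inj)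

lastImages-insertLasts : ∀ {n s} (cs : Vec (Fin (suc n)) s) σs → lastImages (insertLasts cs σs) ≡ cs
lastImages-insertLasts []       []       = refl
lastImages-insertLasts (c ∷ cs) (σ ∷ σs) = cong₂ _∷_ (insertLast-last c σ) (lastImages-insertLasts cs σs)

deleteLasts-insertLasts : ∀ {n s} (cs : Vec (Fin (suc n)) s) σs → deleteLasts (insertLasts cs σs) ≡ σs
deleteLasts-insertLasts []       []       = refl
deleteLasts-insertLasts (c ∷ cs) (σ ∷ σs) =
  cong₂ _∷_ (deleteLast-insertLast c σ) (deleteLasts-insertLasts cs σs)

insertLasts-deleteLasts : ∀ {n s} {σ′s : Vec (Perm-data (suc n)) s} → VAll.All IsPerm σ′s →
  insertLasts (lastImages σ′s) (deleteLasts σ′s) ≡ σ′s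
insertLasts-deleteLasts []                                = refl
insertLasts-deleteLasts {σ′s = σ′ ∷ _} (σ′-inj ∷ σ′s-inj) =
  cong₂ _∷_ (insertLast-deleteLast σ′ σ′-inj) (insertLasts-deleteLasts σ′s-inj)

insertLasts-IsPerm : ∀ {n s} (cs : Vec (Fin (suc n)) s) {σs} →
  VAll.All IsPerm σs → VAll.All IsPerm (insertLasts cs σs)
insertLasts-IsPerm []       []                       = []
insertLasts-IsPerm (c ∷ cs) {σ ∷ _} (σ-inj ∷ σs-inj) =
  insertLast-IsPerm c σ σ-inj ∷ insertLasts-IsPerm cs σs-inj

deleteLasts-IsPerm : ∀ {n s} {σ′s : Vec (Perm-data (suc n)) s} →
  VAll.All IsPerm σ′s → VAll.All IsPerm (deleteLasts σ′s)
deleteLasts-IsPerm []                                = []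
deleteLasts-IsPerm {σ′s = σ′ ∷ _} (σ′-inj ∷ σ′s-inj) =
  deleteLast-IsPerm σ′ σ′-inj ∷ deleteLasts-IsPerm σ′s-inj

sumCycles-insertLasts : ∀ {n s} (cs : Vec (Fin (suc n)) s) {σs} → VAll.All IsPerm σs →
  sumCycles (insertLasts cs σs) ≡ sumCycles σs + countLasts cs
sumCycles-insertLasts []       []                        = refl
sumCycles-insertLasts (c ∷ cs) {σ ∷ σs} (σ-inj ∷ σs-inj) =
  trans (cong₂ _+_ (numCycleMins-insertLast c σ σ-inj) (sumCycles-insertLasts cs σs-inj))
        (+-interchange (numCycleMins σ) (b2n (isLast c)) (sumCycles σs) (countLasts cs))

chainCond-insertLasts : ∀ {n s} (cs : Vec (Fin (suc n)) s) {σs} → VAll.All IsPerm σs →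
  chainCond (insertLasts cs σs) ≡ chainCond σs ∧ lastsFirst true cs
chainCond-insertLasts []           []       = refl
chainCond-insertLasts (c ∷ [])     (_ ∷ []) = refl
chainCond-insertLasts (c ∷ d ∷ cs) {σ ∷ τ ∷ σs} (σ-inj ∷ τ-inj ∷ σs-inj) = trans
  (cong₂ _∧_ (minSubset-insertLast c d τ σ τ-inj σ-inj) (chainCond-insertLasts (d ∷ cs) (τ-inj ∷ σs-inj)))
  (regroup (minSubset τ σ) (chainCond (τ ∷ σs)) (isLast c) (isLast d) (lastsFirst (isLast d) cs))
  where
  regroup : ∀ a b p q y → (a ∧ (not q ∨ p)) ∧ (b ∧ y) ≡ (a ∧ b) ∧ ((p ∨ not q) ∧ y)
  regroup false b     p     q     y = refl
  regroup true  false p     q     y = ∧-comm (not q ∨ p) false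
  regroup true  true  true  true  y = refl
  regroup true  true  true  false y = refl
  regroup true  true  false true  y = refl
  regroup true  true  false false y = refl

-- The tuples of the theorem, with the cycle count shifted by o; Tuples n s k is Tuples′ n s 0 (k + s ∸ 1).
Tuples′ : (n s o m : ℕ) → Set
Tuples′ n s o m = Σ (Vec (Perm-data n) s) λ σs →
  T (allPerms σs) × T (chainCond σs) × T (o + sumCycles σs ≡ᵇ m)

Tuples′-≡ : ∀ {n s o m} {σs τs : Vec (Perm-data n) s} {p p′ q q′ r r′} → σs ≡ τs →
  _≡_ {A = Tuples′ n s o m} (σs , p , q , r) (τs , p′ , q′ , r′)
Tuples′-≡ {p = p} {p′} {q} {q′} {r} {r′} refl
  rewrite T-irrelevant p p′ | T-irrelevant q q′ | T-irrelevant r r′ = refl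

LastChoices : (n s : ℕ) → Bool → (ℕ → Set) → Set
LastChoices n s b B = Σ (Vec (Fin (suc n)) s) λ cs → T (lastsFirst b cs) × B (countLasts cs)

Split-≡ : ∀ {n s o m} {cs ds : Vec (Fin (suc n)) s} {σs τs : Vec (Perm-data n) s} {l l′ p p′ q q′ r r′} →
  cs ≡ ds → σs ≡ τs → _≡_ {A = LastChoices n s true (λ x → Tuples′ n s (o + x) m)}
                          (cs , l , σs , p , q , r) (ds , l′ , τs , p′ , q′ , r′)
Split-≡ {l = l} {l′} {p} {p′} {q} {q′} {r} {r′} refl refl
  rewrite T-irrelevant l l′ | T-irrelevant p p′ | T-irrelevant q q′ | T-irrelevant r r′ = refl

Tuples′-suc↔ : ∀ n s o m → Tuples′ (suc n) s o m ↔ LastChoices n s true (λ x → Tuples′ n s (o + x) m)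
Tuples′-suc↔ n s o m = mk↔ₛ′ split join split∘join join∘split
  where
  total-insertLasts : ∀ cs {σs} → VAll.All IsPerm σs →
    o + sumCycles (insertLasts cs σs) ≡ o + countLasts cs + sumCycles σs
  total-insertLasts cs {σs} σs-inj = begin
    o + sumCycles (insertLasts cs σs)      ≡⟨ cong (o +_) (sumCycles-insertLasts cs σs-inj) ⟩
    o + (sumCycles σs + countLasts cs)     ≡⟨ cong (o +_) (+-comm (sumCycles σs) (countLasts cs)) ⟩
    o + (countLasts cs + sumCycles σs)     ≡⟨ sym (+-assoc o (countLasts cs) (sumCycles σs)) ⟩
    o + countLasts cs + sumCycles σs       ∎
    where open ≡-Reasoning

  split : Tuples′ (suc n) s o m → LastChoices n s true (λ x → Tuples′ n s (o + x) m)
  split (σ′s , perms , chain , total) =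
    cs , proj₂ chain′ , σs , All⇒allPerms σs-inj , proj₁ chain′ , total′
    where
    σ′s-inj = allPerms⇒All σ′s perms
    cs = lastImages σ′s
    σs = deleteLasts σ′s
    σs-inj = deleteLasts-IsPerm σ′s-inj
    recover : insertLasts cs σs ≡ σ′s
    recover = insertLasts-deleteLasts σ′s-inj
    chain′ : T (chainCond σs) × T (lastsFirst true cs)
    chain′ = Equivalence.to T-∧
      (subst T (chainCond-insertLasts cs σs-inj) (subst (T ∘ chainCond) (sym recover) chain))
    total′ : T (o + countLasts cs + sumCycles σs ≡ᵇ m)
    total′ = subst (λ z → T (z ≡ᵇ m)) (total-insertLasts cs σs-inj)
               (subst (λ z → T (o + sumCycles z ≡ᵇ m)) (sym recover) total)

  join : LastChoices n s true (λ x → Tuples′ n s (o + x) m) → Tuples′ (suc n) s o m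
  join (cs , lasts , σs , perms , chain , total) =
    insertLasts cs σs ,
    All⇒allPerms (insertLasts-IsPerm cs σs-inj) ,
    subst T (sym (chainCond-insertLasts cs σs-inj)) (Equivalence.from T-∧ (chain , lasts)) ,
    subst (λ z → T (z ≡ᵇ m)) (sym (total-insertLasts cs σs-inj)) total
    where σs-inj = allPerms⇒All σs perms

  split∘join : ∀ y → split (join y) ≡ y
  split∘join (cs , _ , σs , _) =
    Split-≡ {n} {s} {o} {m} (lastImages-insertLasts cs σs) (deleteLasts-insertLasts cs σs)

  join∘split : ∀ x → join (split x) ≡ x
  join∘split (σ′s , perms , _) =
    Tuples′-≡ {suc n} {s} {o} {m} (insertLasts-deleteLasts (allPerms⇒All σ′s perms))

Card : Set → ℕ → Set
Card A N = A ↔ Fin N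

Card-⊎ : ∀ {A B a b} → Card A a → Card B b → Card (A ⊎ B) (a + b)
Card-⊎ A↔a B↔b = ↔-trans (A↔a ⊎-↔ B↔b) (↔-sym +↔⊎)

Card-× : ∀ {A B a b} → Card A a → Card B b → Card (A × B) (a * b)
Card-× A↔a B↔b = ↔-trans (A↔a ×-↔ B↔b) (↔-sym *↔×)

Card-T : ∀ b → Card (T b) (b2n b)
Card-T true  = ↔-sym 1↔⊤
Card-T false = ↔-sym 0↔⊥

Card-empty : ∀ {A : Set} → (A → ⊥) → Card A 0
Card-empty ¬A = ↔-trans (mk↔ₛ′ ¬A (λ ()) (λ ()) (⊥-elim ∘ ¬A)) (↔-sym 0↔⊥)

Σ-Fin-suc↔ : ∀ {n} (P : Fin (suc n) → Set) → Σ (Fin (suc n)) P ↔ (P (fromℕ n) ⊎ Σ (Fin n) (P ∘ inject₁))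
Σ-Fin-suc↔ {n} P =
  mk↔ₛ′ (λ (c , y) → to c (lastView c) y) from to∘from (λ (c , y) → from∘to c (lastView c) y)
  where
  to : ∀ c → LastView c → P c → P (fromℕ n) ⊎ Σ (Fin n) (P ∘ inject₁)
  to _ last      y = inj₁ y
  to _ (inner j) y = inj₂ (j , y)
  from : P (fromℕ n) ⊎ Σ (Fin n) (P ∘ inject₁) → Σ (Fin (suc n)) P
  from (inj₁ y)       = fromℕ n , y
  from (inj₂ (j , y)) = inject₁ j , y
  to∘from : ∀ z → to (proj₁ (from z)) (lastView (proj₁ (from z))) (proj₂ (from z)) ≡ z
  to∘from (inj₁ y)       rewrite lastView-fromℕ n = refl
  to∘from (inj₂ (j , y)) rewrite lastView-inject₁ j = refl
  from∘to : ∀ c (v : LastView c) y → from (to c v y) ≡ (c , y)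
  from∘to _ last      y = refl
  from∘to _ (inner j) y = refl

-- The number of c ∈ Fin (1 + n) ^ s satisfying lastsFirst b, weighted by h (countLasts c):
-- a leading block of a lasts followed by s ∸ a free choices among the n other values.
choiceCount : ℕ → (ℕ → ℕ) → ℕ → Bool → ℕ
choiceCount n h s true  = sumBelow (suc s) (λ a → weight s n a * h a)
choiceCount n h s false = n ^ s * h 0

card-LastChoices : ∀ n s b (B : ℕ → Set) (h : ℕ → ℕ) → (∀ x → Card (B x) (h x)) →
  Card (LastChoices n s b B) (choiceCount n h s b)
card-LastChoices n zero b B h card = ↔-trans nil↔ (subst (Card (B 0)) (count b) (card 0))
  where
  nil↔ : LastChoices n 0 b B ↔ B 0
  nil↔ = mk↔ₛ′ (λ { ([] , _ , y) → y }) (λ y → [] , tt , y) (λ _ → refl) (λ { ([] , tt , _) → refl })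
  count : ∀ b → h 0 ≡ choiceCount n h 0 b
  count true  = sym (trans (+-identityʳ (1 * h 0)) (*-identityˡ (h 0)))
  count false = sym (*-identityˡ (h 0))
card-LastChoices n (suc s) b B h card =
  ↔-trans cons↔ (↔-trans (Σ-Fin-suc↔ (Head b ∘ isLast)) (↔-trans (last↔ ⊎-↔ inner↔) (byAllowance b)))
  where
  Head : Bool → Bool → Set
  Head b ℓ = Σ (Vec (Fin (suc n)) s) λ cs → T ((b ∨ not ℓ) ∧ lastsFirst ℓ cs) × B (b2n ℓ + countLasts cs)
  cons↔ : LastChoices n (suc s) b B ↔ Σ (Fin (suc n)) (Head b ∘ isLast)
  cons↔ = mk↔ₛ′ (λ { (c ∷ cs , t , y) → c , cs , t , y }) (λ (c , cs , t , y) → c ∷ cs , t , y)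
    (λ _ → refl) (λ { (_ ∷ _ , _ , _) → refl })
  last↔ : Head b (isLast (fromℕ n)) ↔ Head b true
  last↔ = subst (λ ℓ → Head b ℓ ↔ Head b true) (sym (isLast-fromℕ n)) ↔-refl
  inner↔ : Σ (Fin n) (Head b ∘ isLast ∘ inject₁) ↔ (Fin n × Head b false)
  inner↔ = mk↔ₛ′
    (λ (j , y) → j , subst (Head b) (isLast-inject₁ j) y)
    (λ (j , y) → j , subst (Head b) (sym (isLast-inject₁ j)) y)
    (λ (j , _) → cong (j ,_) (subst-subst-sym (isLast-inject₁ j)))
    (λ (j , _) → cong (j ,_) (subst-sym-subst (isLast-inject₁ j)))
  rest : ∀ b → Card (Fin n × Head b false) (n * choiceCount n h s false)
  rest true  = Card-× ↔-refl (card-LastChoices n s false B h card)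
  rest false = Card-× ↔-refl (card-LastChoices n s false B h card)
  -- Only while a last is still allowed can the first coordinate be the last element.
  byAllowance : ∀ b → Card (Head b true ⊎ (Fin n × Head b false)) (choiceCount n h (suc s) b)
  byAllowance true  =
    subst (Card _) count (Card-⊎ (card-LastChoices n s true (B ∘ suc) (h ∘ suc) (card ∘ suc)) (rest true))
    where
    shifted = choiceCount n (h ∘ suc) s true
    count : shifted + n * (n ^ s * h 0) ≡ n * n ^ s * h 0 + shifted
    count = trans (+-comm shifted (n * (n ^ s * h 0))) (cong (_+ shifted) (sym (*-assoc n (n ^ s) (h 0))))
  byAllowance false =
    subst (Card _) (sym (*-assoc n (n ^ s) (h 0))) (Card-⊎ (Card-empty (λ ())) (rest false))

sumCycles-0 : ∀ {s} (σs : Vec (Perm-data 0) s) → sumCycles σs ≡ 0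
sumCycles-0 []       = refl
sumCycles-0 ([] ∷ σs) = sumCycles-0 σs

allPerms-0 : ∀ {s} (σs : Vec (Perm-data 0) s) → T (allPerms σs)
allPerms-0 []       = tt
allPerms-0 ([] ∷ σs) = allPerms-0 σs

chainCond-0 : ∀ {s} (σs : Vec (Perm-data 0) s) → T (chainCond σs)
chainCond-0 []            = tt
chainCond-0 ([] ∷ [])     = tt
chainCond-0 ([] ∷ [] ∷ σs) = chainCond-0 ([] ∷ σs)

Perm-data-0-replicate : ∀ {s} (σs : Vec (Perm-data 0) s) → σs ≡ V.replicate s []
Perm-data-0-replicate []        = refl
Perm-data-0-replicate ([] ∷ σs) = cong ([] ∷_) (Perm-data-0-replicate σs)

Tuples′-0↔ : ∀ s o m → Tuples′ 0 s o m ↔ T (o ≡ᵇ m)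
Tuples′-0↔ s o m = mk↔ₛ′ to from (λ _ → T-irrelevant _ _)
  (λ (σs , _) → Tuples′-≡ {0} {s} {o} {m} (sym (Perm-data-0-replicate σs)))
  where
  total≡o : ∀ σs → o + sumCycles σs ≡ o
  total≡o σs = trans (cong (o +_) (sumCycles-0 σs)) (+-identityʳ o)
  to : Tuples′ 0 s o m → T (o ≡ᵇ m)
  to (σs , _ , _ , total) = subst (λ z → T (z ≡ᵇ m)) (total≡o σs) total
  from : T (o ≡ᵇ m) → Tuples′ 0 s o m
  from t = σs , allPerms-0 σs , chainCond-0 σs , subst (λ z → T (z ≡ᵇ m)) (sym (total≡o σs)) t
    where σs = V.replicate s []

card-Tuples′ : ∀ n s o m → Card (Tuples′ n s o m) (Conv s (upTo n) (δ m) o)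
card-Tuples′ zero    s o m = ↔-trans (Tuples′-0↔ s o m) (Card-T (o ≡ᵇ m))
card-Tuples′ (suc n) s o m = ↔-trans (Tuples′-suc↔ n s o m)
  (subst (Card _) count (card-LastChoices n s true _ _ (λ x → card-Tuples′ n s (o + x) m)))
  where
  count : Conv s (n L.∷ upTo n) (δ m) o ≡ Conv s (upTo (suc n)) (δ m) o
  count = trans (sym (Conv-∷ʳ s (upTo n) n (δ m) o)) (cong (λ ys → Conv s ys (δ m) o) (LP.upTo-∷ʳ n))

filter-map : ∀ {A B : Set} {P : B → Set} (P? : ∀ x → Dec (P x)) (f : A → B) xs →
  filter P? (L.map f xs) ≡ L.map f (filter (P? ∘ f) xs)
filter-map P? f []       = refl
filter-map P? f (x ∷ xs) with does (P? (f x))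
... | true  = cong (f x ∷_) (filter-map P? f xs)
... | false = filter-map P? f xs

sum-map-*ˡ : ∀ {A : Set} c (f : A → ℕ) xs → sum (L.map (λ x → c * f x) xs) ≡ c * sum (L.map f xs)
sum-map-*ˡ c f []       = sym (*-zeroʳ c)
sum-map-*ˡ c f (x ∷ xs) = trans (cong (c * f x +_) (sum-map-*ˡ c f xs)) (sym (*-distribˡ-+ c (f x) _))

sum-map-++ : ∀ {A : Set} (f : A → ℕ) xs ys →
  sum (L.map f (xs ++ ys)) ≡ sum (L.map f xs) + sum (L.map f ys)
sum-map-++ f xs ys = trans (cong sum (LP.map-++ f xs ys)) (sum-++ (L.map f xs) (L.map f ys))

module _ (s : ℕ) where

  tupleWeight : List ℕ → List ℕ → ℕ
  tupleWeight ys as = product (zipWith (weight s) ys as)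

  -- E s k evaluated at 1/y₁, …, 1/yₘ and multiplied by (y₁ ⋯ yₘ) ^ s; o is an offset of the degree.
  clearedE : List ℕ → ℕ → ℕ → ℕ
  clearedE ys o k =
    sum (L.map (tupleWeight ys) (filter (λ as → k ≟ o + sum as) (boundedTuples s (length ys))))

  clearedE-∷ : ∀ y ys o k →
    clearedE (y ∷ ys) o k ≡ sumBelow (suc s) (λ a → weight s y a * clearedE ys (o + a) k)
  clearedE-∷ y ys o k =
    trans (splitFirst (upTo (suc s))) (cong sum (LP.map-applyUpTo id _ (suc s)))
    where
    B = boundedTuples s (length ys)
    W = tupleWeight (y ∷ ys)
    degree? : ∀ o′ as → Dec (k ≡ o′ + sum as)
    degree? o′ as = k ≟ o′ + sum as
    count : ℕ → List (List ℕ) → ℕ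
    count o′ = sum ∘ L.map (tupleWeight ys) ∘ filter (degree? o′)

    withFirst : ∀ a → sum (L.map W (filter (degree? o) (L.map (a ∷_) B))) ≡ weight s y a * count (o + a) B
    withFirst a = begin
      sum (L.map W (filter (degree? o) (L.map (a ∷_) B)))
        ≡⟨ cong (sum ∘ L.map W) (filter-map (degree? o) (a ∷_) B) ⟩
      sum (L.map W (L.map (a ∷_) (filter (λ as → k ≟ o + (a + sum as)) B)))
        ≡⟨ cong (sum ∘ L.map W ∘ L.map (a ∷_)) (LP.filter-≐ (λ as → k ≟ o + (a + sum as)) (degree? (o + a))
             ((λ {as} e → trans e (sym (+-assoc o a (sum as)))) , (λ {as} e → trans e (+-assoc o a (sum as)))) B) ⟩
      sum (L.map W (L.map (a ∷_) (filter (degree? (o + a)) B)))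
        ≡⟨ cong sum (sym (LP.map-∘ (filter (degree? (o + a)) B))) ⟩
      sum (L.map (λ as → weight s y a * tupleWeight ys as) (filter (degree? (o + a)) B))
        ≡⟨ sum-map-*ˡ (weight s y a) (tupleWeight ys) (filter (degree? (o + a)) B) ⟩
      weight s y a * count (o + a) B ∎
      where open ≡-Reasoning

    splitFirst : ∀ A → sum (L.map W (filter (degree? o) (concatMap (λ a → L.map (a ∷_) B) A)))
                      ≡ sum (L.map (λ a → weight s y a * count (o + a) B) A)
    splitFirst []      = refl
    splitFirst (a ∷ A) = begin
      sum (L.map W (filter (degree? o) (L.map (a ∷_) B ++ rest)))
        ≡⟨ cong (sum ∘ L.map W) (LP.filter-++ (degree? o) (L.map (a ∷_) B) rest) ⟩
      sum (L.map W (filter (degree? o) (L.map (a ∷_) B) ++ filter (degree? o) rest))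
        ≡⟨ sum-map-++ W (filter (degree? o) (L.map (a ∷_) B)) (filter (degree? o) rest) ⟩
      sum (L.map W (filter (degree? o) (L.map (a ∷_) B))) + sum (L.map W (filter (degree? o) rest))
        ≡⟨ cong₂ _+_ (withFirst a) (splitFirst A) ⟩
      weight s y a * count (o + a) B + sum (L.map (λ a → weight s y a * count (o + a) B) A) ∎
      where
      open ≡-Reasoning
      rest = concatMap (λ a → L.map (a ∷_) B) A

  clearedE-[] : ∀ o k → clearedE [] o k ≡ δ k o
  clearedE-[] o k with k ≟ o + 0
  ... | yes k≡o+0 = trans (cong (sum ∘ L.map (tupleWeight [])) (LP.filter-accept P? k≡o+0))
                          (sym (δ-≡ (sym (trans k≡o+0 (+-identityʳ o)))))
    where P? = λ (as : List ℕ) → k ≟ o + sum as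
  ... | no  k≢o+0 = trans (cong (sum ∘ L.map (tupleWeight [])) (LP.filter-reject P? k≢o+0))
                          (sym (δ-≢ (λ o≡k → k≢o+0 (trans (sym o≡k) (sym (+-identityʳ o))))))
    where P? = λ (as : List ℕ) → k ≟ o + sum as

  clearedE≡Conv : ∀ ys o k → clearedE ys o k ≡ Conv s ys (δ k) o
  clearedE≡Conv []       o k = clearedE-[] o k
  clearedE≡Conv (y ∷ ys) o k = trans (clearedE-∷ y ys o k)
    (sumBelow-cong (suc s) (λ a → cong (weight s y a *_) (clearedE≡Conv ys (o + a) k)))

ι : ℕ → ℚ
ι a = ℤ.+ a ℚ./ 1

ι≃ : ∀ a → toℚᵘ (ι a) ℚᵘ.≃ ℚᵘ.mkℚᵘ (ℤ.+ a) 0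
ι≃ a = ℚP.toℚᵘ-fromℚᵘ (ℚᵘ.mkℚᵘ (ℤ.+ a) 0)

ι-+ : ∀ a b → ι (a + b) ≡ ι a ℚ.+ ι b
ι-+ a b = ℚP.toℚᵘ-injective (ℚᵘP.≃-trans (ι≃ (a + b)) (ℚᵘP.≃-trans (ℚᵘ.*≡* cross)
  (ℚᵘP.≃-sym (ℚᵘP.≃-trans (ℚP.toℚᵘ-homo-+ (ι a) (ι b)) (ℚᵘP.+-cong (ι≃ a) (ι≃ b))))))
  where
  cross : ℤ.+ (a + b) ℤ.* (ℤ.+ 1 ℤ.* ℤ.+ 1) ≡ (ℤ.+ a ℤ.* ℤ.+ 1 ℤ.+ ℤ.+ b ℤ.* ℤ.+ 1) ℤ.* ℤ.+ 1
  cross = begin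
    ℤ.+ (a + b) ℤ.* (ℤ.+ 1 ℤ.* ℤ.+ 1)          ≡⟨ ℤP.*-identityʳ _ ⟩
    ℤ.+ (a + b)                                ≡⟨ ℤP.pos-+ a b ⟩
    ℤ.+ a ℤ.+ ℤ.+ b
      ≡⟨ sym (cong₂ ℤ._+_ (ℤP.*-identityʳ (ℤ.+ a)) (ℤP.*-identityʳ (ℤ.+ b))) ⟩
    ℤ.+ a ℤ.* ℤ.+ 1 ℤ.+ ℤ.+ b ℤ.* ℤ.+ 1        ≡⟨ sym (ℤP.*-identityʳ _) ⟩
    (ℤ.+ a ℤ.* ℤ.+ 1 ℤ.+ ℤ.+ b ℤ.* ℤ.+ 1) ℤ.* ℤ.+ 1 ∎
    where open ≡-Reasoning

ι-* : ∀ a b → ι (a * b) ≡ ι a ℚ.* ι b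
ι-* a b = ℚP.toℚᵘ-injective (ℚᵘP.≃-trans (ι≃ (a * b))
  (ℚᵘP.≃-trans (ℚᵘ.*≡* (cong (ℤ._* ℤ.+ 1) (ℤP.pos-* a b)))
    (ℚᵘP.≃-sym (ℚᵘP.≃-trans (ℚP.toℚᵘ-homo-* (ι a) (ι b)) (ℚᵘP.*-cong (ι≃ a) (ι≃ b))))))

ι-^ : ∀ a e → ι a ^ℚ e ≡ ι (a ^ e)
ι-^ a zero    = refl
ι-^ a (suc e) = trans (cong (ι a ℚ.*_) (ι-^ a e)) (sym (ι-* a (a ^ e)))

1/suc : ℕ → ℚ
1/suc i = ℤ.+ 1 ℚ./ suc i

ι-*-1/suc : ∀ i → ι (suc i) ℚ.* 1/suc i ≡ 1ℚ
ι-*-1/suc i = ℚP.toℚᵘ-injective (ℚᵘP.≃-trans (ℚP.toℚᵘ-homo-* (ι (suc i)) (1/suc i)) (ℚᵘP.≃-trans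
  (ℚᵘP.*-cong (ι≃ (suc i)) (ℚP.toℚᵘ-fromℚᵘ (ℚᵘ.mkℚᵘ (ℤ.+ 1) i))) (ℚᵘ.*≡* cross)))
  where
  cross : (ℤ.+ suc i ℤ.* ℤ.+ 1) ℤ.* ℤ.+ 1 ≡ ℤ.+ 1 ℤ.* ℤ.+ (1 * suc i)
  cross = trans (ℤP.*-identityʳ _) (trans (ℤP.*-identityʳ _)
    (trans (cong ℤ.+_ (sym (*-identityˡ (suc i)))) (sym (ℤP.*-identityˡ _))))

^ℚ-distribʳ-* : ∀ p q e → (p ℚ.* q) ^ℚ e ≡ (p ^ℚ e) ℚ.* (q ^ℚ e)
^ℚ-distribʳ-* p q zero    = sym (ℚP.*-identityˡ 1ℚ)
^ℚ-distribʳ-* p q (suc e) =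
  trans (cong ((p ℚ.* q) ℚ.*_) (^ℚ-distribʳ-* p q e)) (*-interchangeℚ p q (p ^ℚ e) (q ^ℚ e))

ι-^-*-1/suc-^ : ∀ i s a → a ≤ s → ι (suc i) ^ℚ s ℚ.* (1/suc i ^ℚ a) ≡ ι (suc i ^ (s ∸ a))
ι-^-*-1/suc-^ i s       zero    _         = trans (ℚP.*-identityʳ _) (ι-^ (suc i) s)
ι-^-*-1/suc-^ i (suc s) (suc a) (s≤s a≤s) = begin
  (ι (suc i) ℚ.* ι (suc i) ^ℚ s) ℚ.* (1/suc i ℚ.* 1/suc i ^ℚ a)
    ≡⟨ *-interchangeℚ (ι (suc i)) _ (1/suc i) _ ⟩
  (ι (suc i) ℚ.* 1/suc i) ℚ.* (ι (suc i) ^ℚ s ℚ.* 1/suc i ^ℚ a)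
    ≡⟨ cong₂ ℚ._*_ (ι-*-1/suc i) (ι-^-*-1/suc-^ i s a a≤s) ⟩
  1ℚ ℚ.* ι (suc i ^ (s ∸ a))
    ≡⟨ ℚP.*-identityˡ _ ⟩
  ι (suc i ^ (s ∸ a)) ∎
  where open ≡-Reasoning

clear-monomial : ∀ s is as → length as ≡ length is → All (_≤ s) as →
  ι (product (L.map suc is)) ^ℚ s ℚ.* prodℚ (zipWith _^ℚ_ (L.map 1/suc is) as)
    ≡ ι (tupleWeight s (L.map suc is) as)
clear-monomial s []       []       _   _ = trans (ℚP.*-identityʳ _) (trans (ι-^ 1 s) (cong ι (^-zeroˡ s)))
clear-monomial s (i ∷ is) (a ∷ as) len (a≤s ∷ as≤s) = begin
  ι (suc i * P) ^ℚ s ℚ.* (1/suc i ^ℚ a ℚ.* Z)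
    ≡⟨ cong (λ x → x ^ℚ s ℚ.* (1/suc i ^ℚ a ℚ.* Z)) (ι-* (suc i) P) ⟩
  (ι (suc i) ℚ.* ι P) ^ℚ s ℚ.* (1/suc i ^ℚ a ℚ.* Z)
    ≡⟨ cong (ℚ._* (1/suc i ^ℚ a ℚ.* Z)) (^ℚ-distribʳ-* (ι (suc i)) (ι P) s) ⟩
  (ι (suc i) ^ℚ s ℚ.* ι P ^ℚ s) ℚ.* (1/suc i ^ℚ a ℚ.* Z)
    ≡⟨ *-interchangeℚ (ι (suc i) ^ℚ s) (ι P ^ℚ s) (1/suc i ^ℚ a) Z ⟩
  (ι (suc i) ^ℚ s ℚ.* 1/suc i ^ℚ a) ℚ.* (ι P ^ℚ s ℚ.* Z)
    ≡⟨ cong₂ ℚ._*_ (ι-^-*-1/suc-^ i s a a≤s) (clear-monomial s is as (suc-injective len) as≤s) ⟩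
  ι (suc i ^ (s ∸ a)) ℚ.* ι (tupleWeight s (L.map suc is) as)
    ≡⟨ sym (ι-* (suc i ^ (s ∸ a)) _) ⟩
  ι (tupleWeight s (L.map suc (i ∷ is)) (a ∷ as)) ∎
  where
  open ≡-Reasoning
  P = product (L.map suc is)
  Z = prodℚ (zipWith _^ℚ_ (L.map 1/suc is) as)

boundedTuples-bounded : ∀ s len → All (λ as → length as ≡ len × All (_≤ s) as) (boundedTuples s len)
boundedTuples-bounded s zero      = (refl , []) ∷ []
boundedTuples-bounded s (suc len) = prepend (upTo (suc s)) (AllP.applyUpTo⁺₁ id (suc s) ≤-pred)
  where
  prepend : ∀ A → All (_≤ s) A →
    All (λ as → length as ≡ suc len × All (_≤ s) as) (concatMap (λ a → L.map (a ∷_) (boundedTuples s len)) A)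
  prepend []      []          = []
  prepend (a ∷ A) (a≤s ∷ A≤s) = AllP.++⁺
    (AllP.map⁺ (All.map (λ (len≡ , as≤s) → cong suc len≡ , a≤s ∷ as≤s) (boundedTuples-bounded s len)))
    (prepend A A≤s)

*-distribˡ-sumℚ : ∀ {A : Set} c (g : A → ℚ) xs →
  c ℚ.* sumℚ (L.map g xs) ≡ sumℚ (L.map (λ x → c ℚ.* g x) xs)
*-distribˡ-sumℚ c g []       = ℚP.*-zeroʳ c
*-distribˡ-sumℚ c g (x ∷ xs) =
  trans (ℚP.*-distribˡ-+ c (g x) _) (cong (c ℚ.* g x ℚ.+_) (*-distribˡ-sumℚ c g xs))

sumℚ-ι : ∀ {A : Set} {P : A → Set} (g : A → ℚ) (h : A → ℕ) xs →
  (∀ {x} → P x → g x ≡ ι (h x)) → All P xs → sumℚ (L.map g xs) ≡ ι (sum (L.map h xs))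
sumℚ-ι g h []       g≡ιh []         = refl
sumℚ-ι g h (x ∷ xs) g≡ιh (px ∷ pxs) =
  trans (cong₂ ℚ._+_ (g≡ιh px) (sumℚ-ι g h xs g≡ιh pxs)) (sym (ι-+ (h x) _))

clear-E : ∀ s k is →
  ι (product (L.map suc is)) ^ℚ s ℚ.* E s k (L.map 1/suc is) ≡ ι (clearedE s (L.map suc is) 0 k)
clear-E s k is = begin
  c ℚ.* sumℚ (L.map g (filter P? (boundedTuples s (length (L.map 1/suc is)))))
    ≡⟨ cong (λ len → c ℚ.* sumℚ (L.map g (filter P? (boundedTuples s len))))
            (trans (LP.length-map 1/suc is) (sym (LP.length-map suc is))) ⟩
  c ℚ.* sumℚ (L.map g Bs)
    ≡⟨ *-distribˡ-sumℚ c g Bs ⟩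
  sumℚ (L.map (λ as → c ℚ.* g as) Bs)
    ≡⟨ sumℚ-ι (λ as → c ℚ.* g as) (tupleWeight s (L.map suc is)) Bs
         (λ (len≡ , as≤s) → clear-monomial s is _ (trans len≡ (LP.length-map suc is)) as≤s)
         (AllP.filter⁺ P? (boundedTuples-bounded s (length (L.map suc is)))) ⟩
  ι (clearedE s (L.map suc is) 0 k) ∎
  where
  open ≡-Reasoning
  c = ι (product (L.map suc is)) ^ℚ s
  g = λ as → prodℚ (zipWith _^ℚ_ (L.map 1/suc is) as)
  P? = λ as → k ≟ sum as
  Bs = filter P? (boundedTuples s (length (L.map suc is)))

!≡product : ∀ n → n ! ≡ product (L.map suc (upTo n))
!≡product zero    = refl
!≡product (suc n) = begin
  suc n * n !                        ≡⟨ cong (suc n *_) (!≡product n) ⟩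
  suc n * P                          ≡⟨ *-comm (suc n) P ⟩
  P * suc n                          ≡⟨ cong (P *_) (sym (*-identityʳ (suc n))) ⟩
  P * product (suc n ∷ [])           ≡⟨ sym (product-++ (L.map suc (upTo n)) _) ⟩
  product (L.map suc (upTo n) ++ suc n ∷ [])  ≡⟨ cong product (sym (LP.map-++ suc (upTo n) _)) ⟩
  product (L.map suc (upTo n ∷ʳ n))  ≡⟨ cong (product ∘ L.map suc) (LP.upTo-∷ʳ n) ⟩
  product (L.map suc (upTo (suc n))) ∎
  where
  open ≡-Reasoning
  P = product (L.map suc (upTo n))

modStirling1-suc≡Conv : ∀ s n k →
  modStirling1 s (suc n) (suc k) ≡ ι (Conv s (L.map suc (upTo n)) (δ k) 0)
modStirling1-suc≡Conv s n k = begin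
  ι (n !) ^ℚ s ℚ.* E s k (L.map 1/suc (upTo n))
    ≡⟨ cong (λ z → ι z ^ℚ s ℚ.* E s k (L.map 1/suc (upTo n))) (!≡product n) ⟩
  ι (product (L.map suc (upTo n))) ^ℚ s ℚ.* E s k (L.map 1/suc (upTo n))
    ≡⟨ clear-E s k (upTo n) ⟩
  ι (clearedE s (L.map suc (upTo n)) 0 k)
    ≡⟨ cong ι (clearedE≡Conv s (L.map suc (upTo n)) 0 k) ⟩
  ι (Conv s (L.map suc (upTo n)) (δ k) 0) ∎
  where open ≡-Reasoning

-- Since 0 ∈ upTo (1 + n) carries weight 0, it contributes exactly s to the degree.
Conv-upTo-suc : ∀ s n m → Conv s (upTo (suc n)) (δ (m + s)) 0 ≡ Conv s (L.map suc (upTo n)) (δ m) 0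
Conv-upTo-suc s n m = begin
  Conv s (0 ∷ applyUpTo suc n) (δ (m + s)) 0       ≡⟨ Conv-0∷ s (applyUpTo suc n) (δ (m + s)) 0 ⟩
  Conv s (applyUpTo suc n) (δ (m + s)) s           ≡⟨ cong (λ zs → Conv s zs (δ (m + s)) s) (sym (LP.map-upTo suc n)) ⟩
  Conv s ys (δ (m + s)) (0 + s)                    ≡⟨ Conv-shift s ys (δ (m + s)) 0 s ⟩
  Conv s ys (λ o → δ (m + s) (o + s)) 0            ≡⟨ Conv-cong s ys (λ o → δ-+ʳ m o s) 0 ⟩
  Conv s ys (δ m) 0                                ∎
  where
  open ≡-Reasoning
  ys = L.map suc (upTo n)

Conv-upTo-suc-below : ∀ s n → s ≥ 1 → Conv s (upTo (suc n)) (δ (s ∸ 1)) 0 ≡ 0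
Conv-upTo-suc-below (suc s) n _ = trans (Conv-0∷ (suc s) (applyUpTo suc n) (δ s) 0)
  (Conv-≡0 (suc s) (applyUpTo suc n) (δ s) (suc s) λ o′ s<o′ → δ-≢ λ o′≡s → <-irrefl (sym o′≡s) s<o′)

theorem5p6 : (n k s : ℕ) → n ≥ 1 → s ≥ 1 →
    Σ ℕ λ N → (Tuples n s k ↔ Fin N) × ((ℤ.+ N) ℚ./ 1 ≡ modStirling1 s n k)
theorem5p6 (suc n) k s _ s≥1 =
  Conv s (upTo (suc n)) (δ (k + s ∸ 1)) 0 , card-Tuples′ (suc n) s 0 (k + s ∸ 1) , value k
  where
  value : ∀ k → ι (Conv s (upTo (suc n)) (δ (k + s ∸ 1)) 0) ≡ modStirling1 s (suc n) k
  value zero    = cong ι (Conv-upTo-suc-below s n s≥1)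
  value (suc k) = trans (cong ι (Conv-upTo-suc s n k)) (sym (modStirling1-suc≡Conv s n k))
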